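{- Fix an online cost-minimization problem, a length $n\ge 1$, and a greedy-like online algorithm $G$ for it. Suppose that for every $j$ with $1\le j\le n$, every online algorithm $A$ (over request sequences in $\mathcal{I}_n$) that is $G$-like on the suffix $[j+1,n]$ is also $G$-like extendable on $j$. Then $G$ is bijectively optimal on $\mathcal{I}_n$: for every online algorithm $B$ there exists a bijection $\pi:\mathcal{I}_n\to\mathcal{I}_n$ with $G(\sigma)\le B(\pi(\sigma))$ for all $\sigma\in\mathcal{I}_n$.
   Context: An online cost-minimization problem: requests arrive one at a time and an online algorithm must serve request $\sigma_i$ based only on $\sigma_1,\dots,\sigma_i$; $A(\sigma)$ denotes the total cost of algorithm $A$ on the sequence $\sigma$. $\mathcal{I}_n$ is the (finite) set of all request sequences of length $n$; $\sigma[i,j]$ denotes $\sigma_i\cdots\sigma_j$. An online algorithm is greedy-like if it serves each request $\sigma_i$ in a way that minimizes the cost objective assuming $\sigma_i$ is the final request. For the fixed greedy-like algorithm $G$ there is a (problem-specific) notion of an algorithm $A$ being $G$-like on $\sigma_i$: after having served $\sigma[1,i-1]$ (in whatever way), $A$ serves $\sigma_i$ as $G$ would. $A$ is $G$-like on the suffix $[j,n]$ if it serves all of $\sigma_j,\dots,\sigma_n$ in a $G$-like manner, for every $\sigma\in\mathcal{I}_n$. An online algorithm $A$ that is $G$-like on the suffix $[j+1,n]$ is called $G$-like extendable on $j$ if there exist a bijection $\pi:\mathcal{I}_n\to\mathcal{I}_n$ and an online algorithm $B$ such that: (1) for every $\sigma\in\mathcal{I}_n$, $B$ makes the same decisions as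 $A$ on the first $j-1$ requests of $\sigma$; (2) for every $\sigma\in\mathcal{I}_n$, $B$ is $G$-like on $\sigma_j$; (3) for every $\sigma\in\mathcal{I}_n$, $\pi(\sigma)[1,j]=\sigma[1,j]$ and $B(\pi(\sigma))\le A(\sigma)$. -}

module Defs where

open import Level using (0ℓ)
open import Data.Nat using (ℕ; suc; _<_)
open import Data.Fin using (Fin; toℕ)
open import Data.Product using (Σ; _×_; _,_)
open import Data.List using (List; []; _∷_; _++_; [_]; take; _∷ʳ_)
open import Data.Vec using (Vec; lookup; toList)
open import Relation.Binary.Bundles using (TotalPreorder)
open import Relation.Binary.PropositionalEquality using (_≡_)
open import Function.Bundles using (_⤖_; Bijection)

record OnlineProblem : Set₁ where
  field
    Request  : Set
    Decision : Set
    Cost     : TotalPreorder 0ℓ 0ℓ 0ℓ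
    cost     : List (Request × Decision) → TotalPreorder.Carrier Cost
    -- requests come from a finite set (so that I_n is finite)
    requestsFinite : Σ ℕ λ k → Fin k ⤖ Request

module _ (P : OnlineProblem) where
  open OnlineProblem P

  _≤ᶜ_ : TotalPreorder.Carrier Cost → TotalPreorder.Carrier Cost → Set
  _≤ᶜ_ = TotalPreorder._≲_ Cost

  History : Set
  History = List (Request × Decision)

  -- A deterministic online algorithm: decides how to serve the current
  -- request from the previous requests (in order) and the current request.
  Alg : Set
  Alg = List Request → Request → Decision

  runFrom : Alg → List Request → List Request → History
  runFrom A past []       = []
  runFrom A past (r ∷ rs) = (r , A past r) ∷ runFrom A (past ∷ʳ r) rs

  run : Alg → List Request → History
  run A = runFrom A []

  Seq : ℕ → Set
  Seq n = Vec Request n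

  totalCost : ∀ {n} → Alg → Seq n → TotalPreorder.Carrier Cost
  totalCost A σ = cost (run A (toList σ))

  -- decision of A on request σ_k (0-based position k)
  decisionAt : ∀ {n} → Alg → Seq n → Fin n → Decision
  decisionAt A σ k = A (take (toℕ k) (toList σ)) (lookup σ k)

  -- The greedy-like algorithm G is given by its rule: how G serves the
  -- current request after an arbitrary history ("as G would").
  Rule : Set
  Rule = History → Request → Decision

  ruleRunFrom : Rule → History → List Request → History
  ruleRunFrom g h []       = h
  ruleRunFrom g h (r ∷ rs) = ruleRunFrom g (h ∷ʳ (r , g h r)) rs

  ruleAlg : Rule → Alg
  ruleAlg g past r = g (ruleRunFrom g [] past) r

  GreedyLike : Rule → Set
  GreedyLike g = ∀ (past : List Request) (r : Request) (d : Decision) →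
    cost (run (ruleAlg g) (past ∷ʳ r)) ≤ᶜ cost (run (ruleAlg g) past ∷ʳ (r , d))

  -- A is G-like on σ_k: having served σ[1,k-1] in its own way, it serves σ_k as G would
  GLikeAt : Rule → ∀ {n} → Alg → Seq n → Fin n → Set
  GLikeAt g A σ k =
    decisionAt A σ k ≡ g (run A (take (toℕ k) (toList σ))) (lookup σ k)

  -- A is G-like on the suffix [j+1, n], where j = toℕ j' + 1 (1-based)
  GLikeSuffix : Rule → ∀ {n} → Alg → Fin n → Set
  GLikeSuffix g {n} A j = ∀ (σ : Seq n) (k : Fin n) → toℕ j < toℕ k → GLikeAt g A σ k

  -- A is G-like extendable on j (1-based j = toℕ j' + 1)
  Extendable : Rule → ∀ {n} → Alg → Fin n → Set
  Extendable g {n} A j =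
    Σ (Seq n ⤖ Seq n) λ π → Σ Alg λ B →
      (∀ (σ : Seq n) (k : Fin n) → toℕ k < toℕ j → decisionAt B σ k ≡ decisionAt A σ k)
      × (∀ (σ : Seq n) → GLikeAt g B σ j)
      × (∀ (σ : Seq n) →
           (take (suc (toℕ j)) (toList (Bijection.to π σ)) ≡ take (suc (toℕ j)) (toList σ))
           × (totalCost B (Bijection.to π σ) ≤ᶜ totalCost A σ))

  BijectivelyOptimal : ℕ → Alg → Set
  BijectivelyOptimal n G = ∀ (B : Alg) →
    Σ (Seq n ⤖ Seq n) λ π → ∀ (σ : Seq n) → totalCost G σ ≤ᶜ totalCost B (Bijection.to π σ)

module Submission where

-- Say A' ⊑ A if some bijection π of I_n gives
-- A'(π σ) ≤ A(σ) for all σ; this relation is reflexive and transitive.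
-- By downward induction on t we show that every A has an A' ⊑ A that is
-- G-like from position t on and agrees with A before t: normalise A from
-- t+1, make it G-like at t by the extendability hypothesis, and normalise
-- the result from t+1 again (which keeps position t G-like, since the
-- history before t is unchanged).  For t = 0, A' has G's cost, and
-- inverting the bijection of A' ⊑ B gives G(σ) ≤ B(π σ).

open import Defs
open import Data.Nat using (ℕ; zero; suc; _+_; _≤_; _<_; z≤n; s≤s)
open import Data.Nat.Properties
  using (≤-refl; ≤-reflexive; ≤-trans; <⇒≤; <-irrefl; n≤1+n; m≤n⇒m<n∨m≡n; m<m+n; +-suc; +-identityʳ)
open import Data.Fin using (Fin; toℕ; fromℕ<)
open import Data.Fin.Properties using (toℕ-fromℕ<; toℕ-injective; toℕ<n)
open import Data.Product using (Σ; _,_; proj₂)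
open import Data.Sum using (inj₁; inj₂)
open import Data.Empty using (⊥-elim)
open import Data.List using (List; []; _∷_; _++_; [_]; take; _∷ʳ_)
open import Data.List.Properties using (++-assoc; ++-identityʳ; take-all)
open import Data.Vec using (Vec; lookup; toList) renaming (_∷_ to _∷ᵥ_)
open import Data.Vec.Properties using (length-toList)
open import Relation.Binary.Bundles using (TotalPreorder)
open import Relation.Binary.PropositionalEquality
  using (_≡_; refl; sym; trans; cong; cong₂; subst; module ≡-Reasoning)
open import Function.Base using (_∘_)
open import Function.Bundles using (_⤖_; Bijection)
open import Function.Construct.Identity using (⤖-id)
open import Function.Construct.Composition using (_⤖-∘_)
open import Function.Construct.Symmetry using (⤖-sym)

positionInduction : ∀ {m} (Q : ℕ → Set) → Q 0 →
  (∀ (k : Fin m) → Q (toℕ k) → Q (suc (toℕ k))) → ∀ t → t ≤ m → Q t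
positionInduction Q base step zero    _   = base
positionInduction Q base step (suc t) t<m =
  subst (Q ∘ suc) (toℕ-fromℕ< t<m)
    (step (fromℕ< t<m)
      (subst Q (sym (toℕ-fromℕ< t<m)) (positionInduction Q base step t (<⇒≤ t<m))))

take-suc-toList : ∀ {A : Set} {m} (σ : Vec A m) (k : Fin m) →
  take (suc (toℕ k)) (toList σ) ≡ take (toℕ k) (toList σ) ∷ʳ lookup σ k
take-suc-toList (x ∷ᵥ σ) Fin.zero    = refl
take-suc-toList (x ∷ᵥ σ) (Fin.suc k) = cong (x ∷_) (take-suc-toList σ k)

take-length-toList : ∀ {A : Set} {m} (σ : Vec A m) → take m (toList σ) ≡ toList σ
take-length-toList {m = m} σ = take-all m (toList σ) (≤-reflexive (length-toList σ))

module BackwardInduction (P : OnlineProblem) (n : ℕ) (g : Rule P) where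
  open OnlineProblem P
  module CostOrder = TotalPreorder Cost

  G : Alg P
  G = ruleAlg P g

  runFrom-∷ʳ : (A : Alg P) (past rs : List Request) (r : Request) →
    runFrom P A past (rs ∷ʳ r) ≡ runFrom P A past rs ∷ʳ (r , A (past ++ rs) r)
  runFrom-∷ʳ A past []       r = cong (λ p → [ (r , A p r) ]) (sym (++-identityʳ past))
  runFrom-∷ʳ A past (x ∷ rs) r =
    cong ((x , A past x) ∷_)
      (trans (runFrom-∷ʳ A (past ∷ʳ x) rs r)
             (cong (λ p → runFrom P A (past ∷ʳ x) rs ∷ʳ (r , A p r)) (++-assoc past [ x ] rs)))

  ruleRunFrom-∷ʳ : (h : History P) (rs : List Request) (r : Request) →
    ruleRunFrom P g h (rs ∷ʳ r) ≡ ruleRunFrom P g h rs ∷ʳ (r , g (ruleRunFrom P g h rs) r)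
  ruleRunFrom-∷ʳ h []       r = refl
  ruleRunFrom-∷ʳ h (x ∷ rs) r = ruleRunFrom-∷ʳ (h ∷ʳ (x , g h x)) rs r

  prefixRun : Alg P → Seq P n → ℕ → History P
  prefixRun A σ t = run P A (take t (toList σ))

  prefixRule : Seq P n → ℕ → History P
  prefixRule σ t = ruleRunFrom P g [] (take t (toList σ))

  prefixRun-step : (A : Alg P) (σ : Seq P n) (k : Fin n) →
    prefixRun A σ (suc (toℕ k)) ≡ prefixRun A σ (toℕ k) ∷ʳ (lookup σ k , decisionAt P A σ k)
  prefixRun-step A σ k =
    trans (cong (run P A) (take-suc-toList σ k))
          (runFrom-∷ʳ A [] (take (toℕ k) (toList σ)) (lookup σ k))

  prefixRule-step : (σ : Seq P n) (k : Fin n) →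
    prefixRule σ (suc (toℕ k)) ≡
      prefixRule σ (toℕ k) ∷ʳ (lookup σ k , g (prefixRule σ (toℕ k)) (lookup σ k))
  prefixRule-step σ k =
    trans (cong (ruleRunFrom P g []) (take-suc-toList σ k))
          (ruleRunFrom-∷ʳ [] (take (toℕ k) (toList σ)) (lookup σ k))

  AgreeBefore : Alg P → Alg P → ℕ → Set
  AgreeBefore X Y t = ∀ (σ : Seq P n) (k : Fin n) → toℕ k < t → decisionAt P X σ k ≡ decisionAt P Y σ k

  AgreeBefore-mono : ∀ {X Y s t} → s ≤ t → AgreeBefore X Y t → AgreeBefore X Y s
  AgreeBefore-mono s≤t agree σ k k<s = agree σ k (≤-trans k<s s≤t)

  AgreeBefore-trans : ∀ {X Y Z t} → AgreeBefore X Y t → AgreeBefore Y Z t → AgreeBefore X Z t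
  AgreeBefore-trans XY YZ σ k k<t = trans (XY σ k k<t) (YZ σ k k<t)

  prefixRun-agree : ∀ X Y (σ : Seq P n) t → t ≤ n → AgreeBefore X Y t →
    prefixRun X σ t ≡ prefixRun Y σ t
  prefixRun-agree X Y σ = positionInduction (λ t → AgreeBefore X Y t → prefixRun X σ t ≡ prefixRun Y σ t)
    (λ _ → refl) step
    where
      step : ∀ k → (AgreeBefore X Y (toℕ k) → prefixRun X σ (toℕ k) ≡ prefixRun Y σ (toℕ k)) →
        AgreeBefore X Y (suc (toℕ k)) → prefixRun X σ (suc (toℕ k)) ≡ prefixRun Y σ (suc (toℕ k))
      step k ih agree = begin
        prefixRun X σ (suc (toℕ k))                                ≡⟨ prefixRun-step X σ k ⟩
        prefixRun X σ (toℕ k) ∷ʳ (lookup σ k , decisionAt P X σ k) ≡⟨ cong₂ (λ h d → h ∷ʳ (lookup σ k , d))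
                                                                        (ih (AgreeBefore-mono {X} {Y} (n≤1+n _) agree))
                                                                        (agree σ k ≤-refl) ⟩
        prefixRun Y σ (toℕ k) ∷ʳ (lookup σ k , decisionAt P Y σ k) ≡⟨ sym (prefixRun-step Y σ k) ⟩
        prefixRun Y σ (suc (toℕ k))                                ∎
        where open ≡-Reasoning

  FollowsRule : Alg P → Seq P n → Set
  FollowsRule X σ = ∀ (k : Fin n) → prefixRun X σ (toℕ k) ≡ prefixRule σ (toℕ k) →
    decisionAt P X σ k ≡ g (prefixRule σ (toℕ k)) (lookup σ k)

  totalCost-rule : ∀ X (σ : Seq P n) → FollowsRule X σ →
    totalCost P X σ ≡ cost (ruleRunFrom P g [] (toList σ))
  totalCost-rule X σ follows = begin
    cost (run P X (toList σ))        ≡⟨ cong (cost ∘ run P X) (sym (take-length-toList σ)) ⟩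
    cost (prefixRun X σ n)           ≡⟨ cong cost (positionInduction (λ t → prefixRun X σ t ≡ prefixRule σ t)
                                           refl step n ≤-refl) ⟩
    cost (prefixRule σ n)            ≡⟨ cong (cost ∘ ruleRunFrom P g []) (take-length-toList σ) ⟩
    cost (ruleRunFrom P g [] (toList σ)) ∎
    where
      open ≡-Reasoning
      step : ∀ k → prefixRun X σ (toℕ k) ≡ prefixRule σ (toℕ k) →
        prefixRun X σ (suc (toℕ k)) ≡ prefixRule σ (suc (toℕ k))
      step k ih =
        trans (prefixRun-step X σ k)
          (trans (cong₂ (λ h d → h ∷ʳ (lookup σ k , d)) ih (follows k ih)) (sym (prefixRule-step σ k)))

  GLikeFrom : Alg P → ℕ → Set
  GLikeFrom X t = ∀ (σ : Seq P n) (k : Fin n) → t ≤ toℕ k → GLikeAt P g X σ k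

  GLikeFrom-beyond : ∀ {X t} → n ≤ t → GLikeFrom X t
  GLikeFrom-beyond n≤t σ k t≤k = ⊥-elim (<-irrefl refl (≤-trans (toℕ<n k) (≤-trans n≤t t≤k)))

  -- An algorithm that is G-like everywhere has the same cost as G: both
  -- follow the rule g (G by definition).
  GLike-cost : ∀ X (σ : Seq P n) → GLikeFrom X 0 → totalCost P X σ ≡ totalCost P G σ
  GLike-cost X σ gLike =
    trans (totalCost-rule X σ (λ k same → trans (gLike σ k z≤n) (cong (λ h → g h (lookup σ k)) same)))
          (sym (totalCost-rule G σ (λ k _ → refl)))

  GLikeAt-agree : ∀ X Y (σ : Seq P n) (j : Fin n) → AgreeBefore X Y (suc (toℕ j)) →
    GLikeAt P g Y σ j → GLikeAt P g X σ j
  GLikeAt-agree X Y σ j agree gLike = begin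
    decisionAt P X σ j                       ≡⟨ agree σ j ≤-refl ⟩
    decisionAt P Y σ j                       ≡⟨ gLike ⟩
    g (prefixRun Y σ (toℕ j)) (lookup σ j)   ≡⟨ cong (λ h → g h (lookup σ j))
                                                  (sym (prefixRun-agree X Y σ (toℕ j) (<⇒≤ (toℕ<n j))
                                                         (AgreeBefore-mono {X} {Y} (n≤1+n _) agree))) ⟩
    g (prefixRun X σ (toℕ j)) (lookup σ j)   ∎
    where open ≡-Reasoning

  GLikeFrom-extend : ∀ {X} (j : Fin n) → GLikeFrom X (suc (toℕ j)) → (∀ σ → GLikeAt P g X σ j) →
    GLikeFrom X (toℕ j)
  GLikeFrom-extend j after at σ k j≤k with m≤n⇒m<n∨m≡n j≤k
  ... | inj₁ j<k = after σ k j<k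
  ... | inj₂ j≡k = subst (GLikeAt P g _ σ) (toℕ-injective j≡k) (at σ)

  _⊑_ : Alg P → Alg P → Set
  X ⊑ Y = Σ (Seq P n ⤖ Seq P n) λ π → ∀ σ → _≤ᶜ_ P (totalCost P X (Bijection.to π σ)) (totalCost P Y σ)

  ⊑-refl : ∀ {X} → X ⊑ X
  ⊑-refl = ⤖-id _ , λ σ → CostOrder.refl

  ⊑-trans : ∀ {X Y Z} → X ⊑ Y → Y ⊑ Z → X ⊑ Z
  ⊑-trans (π , XY) (ρ , YZ) = π ⤖-∘ ρ , λ σ → CostOrder.trans (XY _) (YZ σ)

  -- X ≼ Y: X is dominated by Y, X(σ) ≤ Y(π σ) for some bijection π;
  -- G is bijectively optimal iff G ≼ B for every B.
  _≼_ : Alg P → Alg P → Set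
  X ≼ Y = Σ (Seq P n ⤖ Seq P n) λ π → ∀ σ → _≤ᶜ_ P (totalCost P X σ) (totalCost P Y (Bijection.to π σ))

  ⊑⇒≼ : ∀ {X Y} → X ⊑ Y → X ≼ Y
  ⊑⇒≼ {X} {Y} (π , XY) = ⤖-sym π , λ σ →
    subst (λ τ → _≤ᶜ_ P (totalCost P X τ) (totalCost P Y (Bijection.to (⤖-sym π) σ)))
          (proj₂ (Bijection.strictlySurjective π σ)) (XY _)

  ≼-cost : ∀ {X X' Y} → (∀ σ → totalCost P X σ ≡ totalCost P X' σ) → X ≼ Y → X' ≼ Y
  ≼-cost {Y = Y} same (π , XY) = π , λ σ →
    subst (λ c → _≤ᶜ_ P c (totalCost P Y (Bijection.to π σ))) (same σ) (XY σ)

  record Normalised (A : Alg P) (t : ℕ) : Set where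
    field
      alg       : Alg P
      gLikeFrom : GLikeFrom alg t
      agrees    : AgreeBefore alg A t
      improves  : alg ⊑ A

  module Normalisation (extendable : ∀ (j : Fin n) (A : Alg P) → GLikeSuffix P g A j → Extendable P g A j) where

    -- One backward step, at the request j: normalisations from j+1 yield
    -- one from j.  A suffix-G-like A₁ is exactly one that is G-like from j+1.
    normalise-step : (j : Fin n) → (∀ A → Normalised A (suc (toℕ j))) → ∀ A → Normalised A (toℕ j)
    normalise-step j normalised A = extend (extendable j N₁.alg N₁.gLikeFrom)
      where
        module N₁ = Normalised (normalised A)

        extend : Extendable P g N₁.alg j → Normalised A (toℕ j)
        extend (π , B , B≈A₁ , B-gLike , B-cost) = record
          { alg       = N₂.alg
          ; gLikeFrom = GLikeFrom-extend j N₂.gLikeFrom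
                          (λ σ → GLikeAt-agree N₂.alg B σ j N₂.agrees (B-gLike σ))
          ; agrees    = AgreeBefore-trans {N₂.alg} {B} {A} (AgreeBefore-mono {N₂.alg} {B} (n≤1+n _) N₂.agrees)
                          (AgreeBefore-trans {B} {N₁.alg} {A} B≈A₁
                                             (AgreeBefore-mono {N₁.alg} {A} (n≤1+n _) N₁.agrees))
          ; improves  = ⊑-trans N₂.improves (⊑-trans B⊑A₁ N₁.improves)
          }
          where
            module N₂ = Normalised (normalised B)
            -- only the cost part of the extension is needed here
            B⊑A₁ : B ⊑ N₁.alg
            B⊑A₁ = π , λ σ → proj₂ (B-cost σ)

    -- Downward induction on the distance d = n - t.
    normalise : ∀ d t → t + d ≡ n → ∀ A → Normalised A t
    normalise zero    t t+0≡n A = record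
      { alg = A ; gLikeFrom = GLikeFrom-beyond (≤-reflexive (trans (sym t+0≡n) (+-identityʳ t)))
      ; agrees = λ σ k _ → refl ; improves = ⊑-refl }
    normalise (suc d) t t+d≡n = subst (λ s → ∀ A → Normalised A s) (toℕ-fromℕ< t<n)
      (normalise-step j (subst (λ s → ∀ A → Normalised A (suc s)) (sym (toℕ-fromℕ< t<n))
                                (normalise d (suc t) (trans (sym (+-suc t d)) t+d≡n))))
      where
        t<n : t < n
        t<n = subst (t <_) t+d≡n (m<m+n t (s≤s z≤n))
        j : Fin n
        j = fromℕ< t<n

    -- For t = 0 the normalisation of B is G-like everywhere, so it costs
    -- what G costs, and inverting its bijection charges G(σ) to B.
    G-optimal : BijectivelyOptimal P n G
    G-optimal B = ≼-cost (λ σ → GLike-cost N.alg σ N.gLikeFrom) (⊑⇒≼ N.improves)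
      where module N = Normalised (normalise n 0 refl B)

theorem1 : (P : OnlineProblem) (n : ℕ) → 1 ≤ n → (g : Rule P) → GreedyLike P g →
    (∀ (j : Fin n) (A : Alg P) → GLikeSuffix P g A j → Extendable P g A j) →
    BijectivelyOptimal P n (ruleAlg P g)
theorem1 P n _ g _ extendable = BackwardInduction.Normalisation.G-optimal P n g extendable
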